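{- Consider a 0-1 knapsack instance with capacity $c$ and $n$ items with weights $w_1 \ge w_2 \ge \cdots \ge w_n$ (all parameters strictly positive integers, $\sum_{i=1}^n w_i > c$, and $w_i \le c$ for all $i$). Let $g\ge 2$ and integers $0=m_0<m_1<m_2<\cdots<m_g=n$ define the partition of $\{1,\ldots,n\}$ into the $g$ groups $\{m_{i-1}+1,\ldots,m_i\}$, $1\le i\le g$, and let $s_i=m_i-m_{i-1}$. Let $\mathbf{x}=(x_1,\ldots,x_n)$ be an inclusionwise maximal solution and let $l_i=\sum_{j=m_{i-1}+1}^{m_i} x_j$ for $1\le i\le g$. Define $$M=\max\Big\{\sum_{i=1}^{g-1} w_{m_{i-1}+1}\, n_i \;:\; n_i\in\mathbb{Z},\ 0\le n_i\le s_i,\ \sum_{i=1}^{g-1} w_{m_i} n_i\le c\Big\},$$ and let $$z=\min\Big\{a\in\{0,1,\ldots,s_g\} : \sum_{i=m_{g-1}+1}^{m_{g-1}+a} w_i > c - M - w_{m_{g-1}+1}\Big\},$$ with $z=s_g$ if this set is empty. Then $l_g\ge z$.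
   Context: A solution is a vector $\mathbf{x}\in\{0,1\}^n$. A solution $\mathbf{x}$ is inclusionwise maximal if $\sum_{i=1}^n w_i x_i \le c$ and there is no index $j$ with $x_j=0$ and $w_j+\sum_{i=1}^n w_i x_i \le c$. An empty sum equals $0$. -}

module Defs where

open import Data.Nat using (ℕ; zero; suc; _+_; _*_; _∸_; _≤_; _<_)
open import Data.Product using (Σ; _×_)
open import Data.Sum using (_⊎_)
open import Relation.Binary.PropositionalEquality using (_≡_)
open import Relation.Nullary using (¬_)

-- Indices are 1-based: a weight/solution vector of length n is a function
-- ℕ → ℕ of which only the values at 1,…,n are ever used.

sumFrom : (ℕ → ℕ) → ℕ → ℕ → ℕ
sumFrom f a zero    = 0
sumFrom f a (suc k) = sumFrom f a k + f (a + suc k)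

sumRange : (ℕ → ℕ) → ℕ → ℕ → ℕ
sumRange f a b = sumFrom f a (b ∸ a)

load : ℕ → (ℕ → ℕ) → (ℕ → ℕ) → ℕ
load n w x = sumFrom (λ i → w i * x i) 0 n

Binary : ℕ → (ℕ → ℕ) → Set
Binary n x = ∀ i → 1 ≤ i → i ≤ n → x i ≤ 1

InclMaximal : ℕ → (ℕ → ℕ) → ℕ → (ℕ → ℕ) → Set
InclMaximal n w c x =
  Binary n x × load n w x ≤ c ×
  (∀ j → 1 ≤ j → j ≤ n → x j ≡ 0 → ¬ (w j + load n w x ≤ c))

size : (ℕ → ℕ) → ℕ → ℕ
size m i = m i ∸ m (i ∸ 1)

FeasibleCounts : ℕ → (ℕ → ℕ) → ℕ → (ℕ → ℕ) → (ℕ → ℕ) → Set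
FeasibleCounts g m c w ns =
  (∀ i → 1 ≤ i → i ≤ g ∸ 1 → ns i ≤ size m i) ×
  sumFrom (λ i → w (m i) * ns i) 0 (g ∸ 1) ≤ c

countsValue : ℕ → (ℕ → ℕ) → (ℕ → ℕ) → (ℕ → ℕ) → ℕ
countsValue g m w ns = sumFrom (λ i → w (suc (m (i ∸ 1))) * ns i) 0 (g ∸ 1)

IsM : ℕ → (ℕ → ℕ) → ℕ → (ℕ → ℕ) → ℕ → Set
IsM g m c w M =
  Σ (ℕ → ℕ) (λ ns → FeasibleCounts g m c w ns × countsValue g m w ns ≡ M) ×
  (∀ ns → FeasibleCounts g m c w ns → countsValue g m w ns ≤ M)

-- Condition  Σ_{i=m_{g-1}+1}^{m_{g-1}+a} w_i > c - M - w_{m_{g-1}+1},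
-- written over ℕ (without truncated subtraction) as
--   c < Σ … + M + w_{m_{g-1}+1}.
ZCond : ℕ → (ℕ → ℕ) → ℕ → (ℕ → ℕ) → ℕ → ℕ → Set
ZCond g m c w M a =
  c < sumFrom w (m (g ∸ 1)) a + M + w (suc (m (g ∸ 1)))

IsZ : ℕ → (ℕ → ℕ) → ℕ → (ℕ → ℕ) → ℕ → ℕ → Set
IsZ g m c w M z =
  (z ≤ size m g × ZCond g m c w M z × (∀ a → a < z → ¬ ZCond g m c w M a))
  ⊎ ((∀ a → a ≤ size m g → ¬ ZCond g m c w M a) × z ≡ size m g)

-- If the last group is not full, it contains an unselected item j, and maximality
-- gives c < w_j + (load of x).  The counts l_1,…,l_{g−1} are feasible for the
-- program defining M, since w_{m_i} l_i ≤ (load of group i) ≤ w_{m_{i−1}+1} l_i;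
-- hence the load of the first g−1 groups is at most M.  The l_g selected items of
-- the last group weigh at most its l_g heaviest items, and w_j ≤ w_{m_{g−1}+1}.
-- So a = l_g satisfies the condition defining z, and z ≤ l_g by minimality.
module Submission where

open import Defs
open import Data.Nat using (ℕ; zero; suc; _+_; _*_; _≤_; _<_; _∸_; z≤n; s≤s; z<s; _≤?_)
open import Data.Nat.Properties
open import Data.Product using (∃; _×_; _,_; proj₁; proj₂)
open import Data.Sum using (inj₁; inj₂)
open import Relation.Nullary using (yes; no; contradiction)
open import Relation.Binary.PropositionalEquality using (_≡_; refl; sym; trans; cong; subst; module ≡-Reasoning)

OnRange : (ℕ → Set) → ℕ → ℕ → Set
OnRange P a s = ∀ j → a < j → j ≤ a + s → P j

OnRange-init : ∀ {P a s} → OnRange P a (suc s) → OnRange P a s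
OnRange-init {a = a} {s} p j a<j j≤a+s = p j a<j (≤-trans j≤a+s (+-monoʳ-≤ a (n≤1+n s)))

OnRange-last : ∀ {P a s} → OnRange P a (suc s) → P (a + suc s)
OnRange-last {a = a} p = p _ (m<m+n a z<s) ≤-refl

weighted : (ℕ → ℕ) → (ℕ → ℕ) → ℕ → ℕ
weighted w x j = w j * x j

sumFrom-+ : ∀ f a k l → sumFrom f a (k + l) ≡ sumFrom f a k + sumFrom f (a + k) l
sumFrom-+ f a k zero rewrite +-identityʳ k = sym (+-identityʳ _)
sumFrom-+ f a k (suc l) rewrite +-assoc a k (suc l) | +-suc k l | sumFrom-+ f a k l =
  +-assoc (sumFrom f a k) _ _

sumFrom-mono-≤ : ∀ {f h} a s → OnRange (λ j → f j ≤ h j) a s → sumFrom f a s ≤ sumFrom h a s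
sumFrom-mono-≤ a zero    f≤h = z≤n
sumFrom-mono-≤ a (suc s) f≤h = +-mono-≤ (sumFrom-mono-≤ a s (OnRange-init f≤h)) (OnRange-last f≤h)

sumFrom-*ˡ : ∀ C f a s → sumFrom (λ j → C * f j) a s ≡ C * sumFrom f a s
sumFrom-*ˡ C f a zero    = sym (*-zeroʳ C)
sumFrom-*ˡ C f a (suc s) rewrite sumFrom-*ˡ C f a s = sym (*-distribˡ-+ C _ _)

sumFrom-≤-length : ∀ f a s → OnRange (λ j → f j ≤ 1) a s → sumFrom f a s ≤ s
sumFrom-≤-length f a zero    f≤1 = z≤n
sumFrom-≤-length f a (suc s) f≤1 =
  subst (sumFrom f a (suc s) ≤_) (+-comm s 1)
    (+-mono-≤ (sumFrom-≤-length f a s (OnRange-init f≤1)) (OnRange-last f≤1))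

sumFrom<length⇒zero : ∀ f a s → sumFrom f a s < s → ∃ λ j → a < j × j ≤ a + s × f j ≡ 0
sumFrom<length⇒zero f a (suc s) sum<s with f (a + suc s) in fj≡
... | zero  = a + suc s , m<m+n a z<s , ≤-refl , fj≡
... | suc v with sumFrom<length⇒zero f a s (<-≤-trans (m<m+n _ z<s) (≤-pred sum<s))
...   | j , a<j , j≤a+s , fj≡0 = j , a<j , ≤-trans j≤a+s (+-monoʳ-≤ a (n≤1+n s)) , fj≡0

module Nonincreasing {n : ℕ} {w : ℕ → ℕ} (w-step : ∀ i → 1 ≤ i → i < n → w (suc i) ≤ w i) where

  antitone : ∀ {i j} → 1 ≤ i → i ≤ j → j ≤ n → w j ≤ w i
  antitone {j = zero}  (s≤s _) ()
  antitone {j = suc j} 1≤i i≤1+j 1+j≤n with m≤n⇒m<n∨m≡n i≤1+j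
  ... | inj₂ refl      = ≤-refl
  ... | inj₁ (s≤s i≤j) =
    ≤-trans (w-step j (≤-trans 1≤i i≤j) 1+j≤n) (antitone 1≤i i≤j (<⇒≤ 1+j≤n))

  weighted≤head*count : ∀ x a s → a + s ≤ n →
    sumFrom (weighted w x) a s ≤ w (suc a) * sumFrom x a s
  weighted≤head*count x a s a+s≤n = begin
    sumFrom (weighted w x) a s           ≤⟨ sumFrom-mono-≤ a s wj≤head ⟩
    sumFrom (λ j → w (suc a) * x j) a s  ≡⟨ sumFrom-*ˡ (w (suc a)) x a s ⟩
    w (suc a) * sumFrom x a s            ∎
    where
    open ≤-Reasoning
    wj≤head : OnRange (λ j → w j * x j ≤ w (suc a) * x j) a s
    wj≤head j a<j j≤a+s = *-monoˡ-≤ (x j) (antitone z<s a<j (≤-trans j≤a+s a+s≤n))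

  last*count≤weighted : ∀ x a s → a + s ≤ n →
    w (a + s) * sumFrom x a s ≤ sumFrom (weighted w x) a s
  last*count≤weighted x a s a+s≤n = begin
    w (a + s) * sumFrom x a s            ≡⟨ sumFrom-*ˡ (w (a + s)) x a s ⟨
    sumFrom (λ j → w (a + s) * x j) a s  ≤⟨ sumFrom-mono-≤ a s last≤wj ⟩
    sumFrom (weighted w x) a s           ∎
    where
    open ≤-Reasoning
    last≤wj : OnRange (λ j → w (a + s) * x j ≤ w j * x j) a s
    last≤wj j a<j j≤a+s = *-monoˡ-≤ (x j) (antitone (≤-trans z<s a<j) j≤a+s a+s≤n)

  weighted≤prefix : ∀ x a s → a + s ≤ n → OnRange (λ j → x j ≤ 1) a s →
    sumFrom (weighted w x) a s ≤ sumFrom w a (sumFrom x a s)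
  weighted≤prefix x a zero    _      _   = z≤n
  weighted≤prefix x a (suc s) a+s≤n x≤1 with x (a + suc s) | OnRange-last x≤1
  ... | zero | _ rewrite *-zeroʳ (w (a + suc s)) | +-identityʳ (sumFrom (weighted w x) a s)
                       | +-identityʳ (sumFrom x a s) =
    weighted≤prefix x a s (≤-trans (+-monoʳ-≤ a (n≤1+n s)) a+s≤n) (OnRange-init x≤1)
  ... | suc zero | _ rewrite *-identityʳ (w (a + suc s)) | +-comm (sumFrom x a s) 1 =
    +-mono-≤ (weighted≤prefix x a s (≤-trans (+-monoʳ-≤ a (n≤1+n s)) a+s≤n) (OnRange-init x≤1))
             (antitone (subst (1 ≤_) (sym (+-suc a _)) z<s)
                       (+-monoʳ-≤ a (s≤s (sumFrom-≤-length x a s (OnRange-init x≤1))))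
                       a+s≤n)
  ... | suc (suc _) | s≤s ()

module Partition {g n : ℕ} {m : ℕ → ℕ}
  (m0 : m 0 ≡ 0) (mg : m g ≡ n) (m-step : ∀ i → i < g → m i < m (suc i)) where

  groupSum : (ℕ → ℕ) → ℕ → ℕ
  groupSum f i = sumFrom f (m (i ∸ 1)) (size m i)

  monotone : ∀ {i j} → i ≤ j → j ≤ g → m i ≤ m j
  monotone {j = zero}  z≤n _ = ≤-refl
  monotone {j = suc j} i≤1+j 1+j≤g with m≤n⇒m<n∨m≡n i≤1+j
  ... | inj₂ refl      = ≤-refl
  ... | inj₁ (s≤s i≤j) = ≤-trans (monotone i≤j (<⇒≤ 1+j≤g)) (<⇒≤ (m-step j 1+j≤g))

  start+size : ∀ i → 1 ≤ i → i ≤ g → m (i ∸ 1) + size m i ≡ m i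
  start+size (suc i) _ 1+i≤g = m+[n∸m]≡n (<⇒≤ (m-step i 1+i≤g))

  group-within : ∀ i → 1 ≤ i → i ≤ g → m (i ∸ 1) + size m i ≤ n
  group-within i 1≤i i≤g rewrite start+size i 1≤i i≤g = subst (m i ≤_) mg (monotone i≤g ≤-refl)

  sumFrom-groups : ∀ f k → k ≤ g → sumFrom f 0 (m k) ≡ sumFrom (groupSum f) 0 k
  sumFrom-groups f zero    _     = cong (sumFrom f 0) m0
  sumFrom-groups f (suc k) 1+k≤g = begin
    sumFrom f 0 (m (suc k))                    ≡⟨ cong (sumFrom f 0) (start+size (suc k) z<s 1+k≤g) ⟨
    sumFrom f 0 (m k + size m (suc k))         ≡⟨ sumFrom-+ f 0 (m k) (size m (suc k)) ⟩
    sumFrom f 0 (m k) + groupSum f (suc k)     ≡⟨ cong (_+ groupSum f (suc k)) (sumFrom-groups f k (<⇒≤ 1+k≤g)) ⟩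
    sumFrom (groupSum f) 0 k + groupSum f (suc k) ∎
    where open ≡-Reasoning

IsZ-≤ : ∀ {g m c w M z} a → IsZ g m c w M z → (a < size m g → ZCond g m c w M a) → z ≤ a
IsZ-≤ a (inj₁ (z≤s , _ , below-z-fails)) cond with _ ≤? a
... | yes z≤a = z≤a
... | no  z≰a = contradiction (cond (<-≤-trans (≰⇒> z≰a) z≤s)) (below-z-fails a (≰⇒> z≰a))
IsZ-≤ a (inj₂ (none , refl)) cond = ≮⇒≥ (λ a<s → none a (<⇒≤ a<s) (cond a<s))

module MaximalSolution {n c g : ℕ} {w m x : ℕ → ℕ} {M : ℕ}
  (w-step : ∀ i → 1 ≤ i → i < n → w (suc i) ≤ w i)
  (1≤g : 1 ≤ g) (m0 : m 0 ≡ 0) (mg : m g ≡ n) (m-step : ∀ i → i < g → m i < m (suc i))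
  (maximal : InclMaximal n w c x) (isM : IsM g m c w M) where

  open Nonincreasing w-step
  open Partition m0 mg m-step

  a s : ℕ
  a = m (g ∸ 1)
  s = size m g

  a+s≡n : a + s ≡ n
  a+s≡n = trans (start+size g 1≤g ≤-refl) mg

  x≤1 : ∀ {b t} → b + t ≤ n → OnRange (λ j → x j ≤ 1) b t
  x≤1 b+t≤n j b<j j≤b+t = proj₁ maximal j (≤-trans z<s b<j) (≤-trans j≤b+t b+t≤n)

  counts : ℕ → ℕ
  counts i = sumFrom x (m (i ∸ 1)) (size m i)

  headLoad : ℕ
  headLoad = sumFrom (weighted w x) 0 a

  load-split : load n w x ≡ headLoad + sumFrom (weighted w x) a s
  load-split = trans (cong (sumFrom (weighted w x) 0) (sym a+s≡n)) (sumFrom-+ (weighted w x) 0 a s)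

  headLoad-groups : headLoad ≡ sumFrom (groupSum (weighted w x)) 0 (g ∸ 1)
  headLoad-groups = sumFrom-groups (weighted w x) (g ∸ 1) (m∸n≤m g 1)

  headLoad≤c : headLoad ≤ c
  headLoad≤c = ≤-trans (m≤m+n headLoad _) (subst (_≤ c) load-split (proj₁ (proj₂ maximal)))

  counts-feasible : FeasibleCounts g m c w counts
  counts-feasible = counts≤size , ≤-trans (sumFrom-mono-≤ 0 (g ∸ 1) tail≤group)
                                          (subst (_≤ c) headLoad-groups headLoad≤c)
    where
    counts≤size : ∀ i → 1 ≤ i → i ≤ g ∸ 1 → counts i ≤ size m i
    counts≤size i 1≤i i≤g-1 =
      sumFrom-≤-length x _ _ (x≤1 (group-within i 1≤i (≤-trans i≤g-1 (m∸n≤m g 1))))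
    tail≤group : OnRange (λ i → w (m i) * counts i ≤ groupSum (weighted w x) i) 0 (g ∸ 1)
    tail≤group i 1≤i i≤g-1 =
      subst (λ e → w e * counts i ≤ groupSum (weighted w x) i) (start+size i 1≤i i≤g)
        (last*count≤weighted x (m (i ∸ 1)) (size m i) (group-within i 1≤i i≤g))
      where
      i≤g : i ≤ g
      i≤g = ≤-trans i≤g-1 (m∸n≤m g 1)

  headLoad≤M : headLoad ≤ M
  headLoad≤M = begin
    headLoad                                                 ≡⟨ headLoad-groups ⟩
    sumFrom (groupSum (weighted w x)) 0 (g ∸ 1)              ≤⟨ sumFrom-mono-≤ 0 (g ∸ 1) group≤head ⟩
    sumFrom (λ i → w (suc (m (i ∸ 1))) * counts i) 0 (g ∸ 1) ≤⟨ proj₂ isM counts counts-feasible ⟩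
    M                                                        ∎
    where
    open ≤-Reasoning
    group≤head : OnRange (λ i → groupSum (weighted w x) i ≤ w (suc (m (i ∸ 1))) * counts i) 0 (g ∸ 1)
    group≤head i 1≤i i≤g-1 =
      weighted≤head*count x _ _ (group-within i 1≤i (≤-trans i≤g-1 (m∸n≤m g 1)))

  unfilled-last-group : counts g < s → ZCond g m c w M (counts g)
  unfilled-last-group l<s with sumFrom<length⇒zero x a s l<s
  ... | j , a<j , j≤a+s , xj≡0 = begin-strict
    c                                                  <⟨ ≰⇒> (proj₂ (proj₂ maximal) j (≤-trans z<s a<j) j≤n xj≡0) ⟩
    w j + load n w x                                   ≡⟨ cong (w j +_) load-split ⟩
    w j + (headLoad + sumFrom (weighted w x) a s)      ≤⟨ +-mono-≤ wj≤head (+-mono-≤ headLoad≤M last≤prefix) ⟩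
    w (suc a) + (M + sumFrom w a (counts g))           ≡⟨ +-comm (w (suc a)) _ ⟩
    M + sumFrom w a (counts g) + w (suc a)             ≡⟨ cong (_+ w (suc a)) (+-comm M _) ⟩
    sumFrom w a (counts g) + M + w (suc a)             ∎
    where
    open ≤-Reasoning
    a+s≤n : a + s ≤ n
    a+s≤n = ≤-reflexive a+s≡n
    j≤n : j ≤ n
    j≤n = ≤-trans j≤a+s a+s≤n
    wj≤head : w j ≤ w (suc a)
    wj≤head = antitone z<s a<j j≤n
    last≤prefix : sumFrom (weighted w x) a s ≤ sumFrom w a (counts g)
    last≤prefix = weighted≤prefix x a s a+s≤n (x≤1 a+s≤n)

theorem3 : (n c g : ℕ) (w m x : ℕ → ℕ) (M z : ℕ) →
    0 < n → 0 < c →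
    (∀ i → 1 ≤ i → i ≤ n → 0 < w i) →
    (∀ i → 1 ≤ i → i < n → w (suc i) ≤ w i) →
    c < sumFrom w 0 n →
    (∀ i → 1 ≤ i → i ≤ n → w i ≤ c) →
    2 ≤ g → m 0 ≡ 0 → m g ≡ n → (∀ i → i < g → m i < m (suc i)) →
    InclMaximal n w c x →
    IsM g m c w M →
    IsZ g m c w M z →
    z ≤ sumRange x (m (g ∸ 1)) (m g)
theorem3 n c g w m x M z _ _ _ w-step _ _ 2≤g m0 mg m-step maximal isM isZ =
  IsZ-≤ {g} {m} (sumRange x (m (g ∸ 1)) (m g)) isZ
    (MaximalSolution.unfilled-last-group w-step (≤-trans (s≤s z≤n) 2≤g) m0 mg m-step maximal isM)
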